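{- Let $k$ be a positive integer, let $M$ be a $k$-entangled matroid and let $e\in E(M)$. Then at least one of $M\backslash e$ and $M/e$ is $k$-entangled.
   Context: A connectivity system is a pair $(E,\lambda)$, $E$ finite, $\lambda$ a non-negative integer-valued function on subsets of $E$ with $\lambda(X)=\lambda(E\setminus X)$ and $\lambda(X\cap Y)+\lambda(X\cup Y)\le\lambda(X)+\lambda(Y)$. $\mathcal S_k(K)$ is the set of $X\subseteq E$ with $\lambda(X)<k$. A tangle of order $k$ in $K$ is a set $\mathcal{T}\subseteq\mathcal S_k(K)$ such that for each $A\in\mathcal S_k(K)$ exactly one of $A$, $E\setminus A$ lies in $\mathcal{T}$, there are no $T_1,T_2,T_3\in\mathcal{T}$ with $T_1\cup T_2\cup T_3=E$, and no set in $\mathcal{T}$ has size $|E|-1$. A connectivity system is $k$-entangled if for each $t\le k$ it has at most one tangle of order $t$. For a matroid $M$ with rank function $r$ and ground set $E$, $\lambda_M(X)=r(X)+r(E\setminus X)-r(M)+1$, $K(M)=(E,\lambda_M)$, and $M$ is $k$-entangled if $K(M)$ is. -}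

module Defs where

open import Data.Nat using (ℕ; suc; _+_; _∸_; _≤_; _<_)
open import Data.Bool using (Bool; true; false; not)
open import Data.Fin using (Fin)
open import Data.Fin.Subset using (Subset; _∩_; _∪_; ∁; ⊤; _⊆_; ∣_∣; ⁅_⁆; inside; outside)
open import Data.Vec using (insertAt)
open import Data.Product using (_×_)
open import Relation.Binary.PropositionalEquality using (_≡_; _≢_)

record Matroid (n : ℕ) : Set where
  field
    rank       : Subset n → ℕ
    rank-bound : ∀ X → rank X ≤ ∣ X ∣
    rank-mono  : ∀ {X Y} → X ⊆ Y → rank X ≤ rank Y
    rank-submod : ∀ X Y → rank (X ∩ Y) + rank (X ∪ Y) ≤ rank X + rank Y
open Matroid public

SetFamily : ℕ → Set
SetFamily n = Subset n → Bool

record IsTangle {n : ℕ} (λ' : Subset n → ℕ) (k : ℕ) (𝒯 : SetFamily n) : Set where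
  field
    inS       : ∀ X → 𝒯 X ≡ true → λ' X < k
    exactlyOne : ∀ A → λ' A < k → 𝒯 A ≡ not (𝒯 (∁ A))
    noCover   : ∀ T₁ T₂ T₃ → 𝒯 T₁ ≡ true → 𝒯 T₂ ≡ true → 𝒯 T₃ ≡ true →
                T₁ ∪ T₂ ∪ T₃ ≢ ⊤
    noBig     : ∀ X → 𝒯 X ≡ true → suc ∣ X ∣ ≢ n

Entangled : {n : ℕ} → (Subset n → ℕ) → ℕ → Set
Entangled {n} λ' k = ∀ t → t ≤ k → ∀ (𝒯 𝒯' : SetFamily n) →
  IsTangle λ' t 𝒯 → IsTangle λ' t 𝒯' → ∀ X → 𝒯 X ≡ 𝒯' X

connFromRank : {n : ℕ} → (Subset n → ℕ) → Subset n → ℕ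
connFromRank r X = r X + r (∁ X) + 1 ∸ r ⊤

MatroidEntangled : {n : ℕ} → Matroid n → ℕ → Set
MatroidEntangled M k = Entangled (connFromRank (rank M)) k

-- Deletion M \ e: ground set E - e ≅ Fin n, rank r(X).
deleteRank : {n : ℕ} → Matroid (suc n) → Fin (suc n) → Subset n → ℕ
deleteRank M e X = rank M (insertAt X e outside)

-- Contraction M / e: ground set E - e ≅ Fin n, rank r(X ∪ e) - r({e}).
contractRank : {n : ℕ} → Matroid (suc n) → Fin (suc n) → Subset n → ℕ
contractRank M e X = rank M (insertAt X e inside) ∸ rank M ⁅ e ⁆

-- A tangle 𝒯 of a minor N ∈ {M \ e, M / e} lifts to the tangle of M consisting of the sets Z
-- with λ_M(Z) < t and Z - e ∈ 𝒯, because λ_N(Z - e) ≤ λ_M(Z).  So if M is k-entangled, two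
-- tangles of N of order t ≤ k agree on every X ⊆ E - e with λ_M(X) < t.
-- Suppose both minors have two distinct tangles, of orders t and s, separated by A (in M \ e)
-- and by B (in M / e).  Bixby's inequality λ_{M\e}(X) + λ_{M/e}(Y) + 1 ≥ λ_M(X ∩ Y) + λ_M(X ∪ Y ∪ e)
-- gives, for each of the four choices of sides of A and B, a quadrant of the cross of M-order
-- below t or its opposite quadrant of M-order below s.  By agreement, two small quadrants on one
-- side of A (or B) then lie in the tangle containing the other side, and these three sets cover E.
-- The disjunction is decided constructively: k-entanglement of M \ e is decidable, by exhaustion.
module Submission where

open import Defs
import Algebra.Lattice.Properties.BooleanAlgebra as BooleanAlgebraProperties
open import Data.Bool using (true; false; not; _∧_; _∨_)
open import Data.Bool.Properties using (not-involutive) renaming (_≟_ to _≟ᵇ_)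
open import Data.Empty using (⊥; ⊥-elim)
open import Data.Fin using (Fin; zero; suc)
open import Data.Fin.Subset using (Subset; _∩_; _∪_; ∁; ⊤; _⊆_; ∣_∣; ⁅_⁆; inside; outside)
  renaming (⊥ to ∅)
open import Data.Fin.Subset.Properties
  using (∪-∩-booleanAlgebra; ∪-assoc; ∪-idem; ∪-zeroˡ; ∪-zeroʳ; ∪-identityʳ; ∪-inverseʳ;
         ∩-comm; ∩-identityʳ; ∩-distribˡ-∪; ⊆⊤; ⊆-antisym; _∈?_; x∈p∪q⁺; x∉p⇒x∈∁p;
         x∈⁅y⁆⇒x≡y; ∣⁅x⁆∣≡1; ∣p∣≤n; ∣p∣≡n⇒p≡⊤; p∩q⊆p; anySubset?)
open import Data.Nat using (ℕ; zero; suc; _+_; _∸_; _≤_; _<_; _<?_; s≤s; s≤s⁻¹)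
  renaming (_≟_ to _≟ℕ_)
open import Data.Nat.Properties
open import Data.Nat.Tactic.RingSolver using (solve-∀)
open import Data.Product using (Σ-syntax; _×_; _,_; proj₁; proj₂)
open import Data.Sum using (_⊎_; inj₁; inj₂; swap)
open import Data.Vec using (Vec; []; _∷_; insertAt; removeAt; lookup; map; zipWith; replicate)
open import Data.Vec.Properties using (≡-dec; map-insertAt; removeAt-insertAt; insertAt-removeAt;
                                       insertAt-lookup; lookup⇒[]=)
open import Function using (_∘_)
open import Relation.Binary.Definitions using (_Respects_)
open import Relation.Binary.PropositionalEquality
open import Relation.Nullary using (Dec; yes; no; ¬_; ¬?; does)
open import Relation.Nullary.Decidable using (map′; _×-dec_; _→-dec_; decidable-stable; dec-true; dec-false)

module _ {n : ℕ} where
  open BooleanAlgebraProperties (∪-∩-booleanAlgebra n) public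
    using () renaming (¬-involutive to ∁-involutive; deMorgan₁ to ∁-∩; deMorgan₂ to ∁-∪)

zipWith-insertAt : ∀ {A B C : Set} {n} (f : A → B → C) (xs : Vec A n) (ys : Vec B n) i x y →
                   zipWith f (insertAt xs i x) (insertAt ys i y) ≡ insertAt (zipWith f xs ys) i (f x y)
zipWith-insertAt f xs ys zero x y = refl
zipWith-insertAt f (x′ ∷ xs) (y′ ∷ ys) (suc i) x y = cong (f x′ y′ ∷_) (zipWith-insertAt f xs ys i x y)

removeAt-zipWith : ∀ {A B C : Set} {n} (f : A → B → C) (xs : Vec A (suc n)) (ys : Vec B (suc n)) i →
                   removeAt (zipWith f xs ys) i ≡ zipWith f (removeAt xs i) (removeAt ys i)
removeAt-zipWith f (x ∷ xs) (y ∷ ys) zero = refl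
removeAt-zipWith f (x ∷ x′ ∷ xs) (y ∷ y′ ∷ ys) (suc i) =
  cong (f x y ∷_) (removeAt-zipWith f (x′ ∷ xs) (y′ ∷ ys) i)

removeAt-map : ∀ {A B : Set} {n} (f : A → B) (xs : Vec A (suc n)) i →
               removeAt (map f xs) i ≡ map f (removeAt xs i)
removeAt-map f (x ∷ xs) zero = refl
removeAt-map f (x ∷ x′ ∷ xs) (suc i) = cong (f x ∷_) (removeAt-map f (x′ ∷ xs) i)

insertAt-replicate : ∀ {A : Set} {n} (x : A) (i : Fin (suc n)) → insertAt (replicate n x) i x ≡ replicate (suc n) x
insertAt-replicate x zero = refl
insertAt-replicate {n = suc n} x (suc i) = cong (x ∷_) (insertAt-replicate x i)

module _ {n : ℕ} where

  ∁-insertAt : ∀ (X : Subset n) i b → ∁ (insertAt X i b) ≡ insertAt (∁ X) i (not b)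
  ∁-insertAt X i b = map-insertAt not b X i

  insertAt-⊤ : ∀ (i : Fin (suc n)) → insertAt ⊤ i inside ≡ ⊤
  insertAt-⊤ = insertAt-replicate inside

  removeAt-⊤ : ∀ (i : Fin (suc n)) → removeAt ⊤ i ≡ ⊤
  removeAt-⊤ i = trans (cong (λ Z → removeAt Z i) (sym (insertAt-⊤ i))) (removeAt-insertAt ⊤ i inside)

  removeAt-∪ : ∀ (X Y : Subset (suc n)) i → removeAt (X ∪ Y) i ≡ removeAt X i ∪ removeAt Y i
  removeAt-∪ = removeAt-zipWith _∨_

  ⁅i⁆⊆insertAt : ∀ (X : Subset n) i → ⁅ i ⁆ ⊆ insertAt X i inside
  ⁅i⁆⊆insertAt X i x∈⁅i⁆ rewrite x∈⁅y⁆⇒x≡y i x∈⁅i⁆ = lookup⇒[]= i _ (insertAt-lookup X i inside)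

insertAt-∅ : ∀ {n} (i : Fin (suc n)) → insertAt ∅ i inside ≡ ⁅ i ⁆
insertAt-∅ zero = refl
insertAt-∅ {suc n} (suc i) = cong (outside ∷_) (insertAt-∅ i)

∣p∣≤1+∣removeAt-p∣ : ∀ {n} (p : Subset (suc n)) i → ∣ p ∣ ≤ suc ∣ removeAt p i ∣
∣p∣≤1+∣removeAt-p∣ (true ∷ p) zero = ≤-refl
∣p∣≤1+∣removeAt-p∣ (false ∷ p) zero = n≤1+n _
∣p∣≤1+∣removeAt-p∣ (true ∷ x ∷ p) (suc i) = s≤s (∣p∣≤1+∣removeAt-p∣ (x ∷ p) i)
∣p∣≤1+∣removeAt-p∣ (false ∷ x ∷ p) (suc i) = ∣p∣≤1+∣removeAt-p∣ (x ∷ p) i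

module _ {n : ℕ} where

  p⊆q⇒q∪∁p≡⊤ : ∀ {p q : Subset n} → p ⊆ q → q ∪ ∁ p ≡ ⊤
  p⊆q⇒q∪∁p≡⊤ {p} {q} p⊆q = ⊆-antisym ⊆⊤ q∪∁p⊇⊤
    where
    q∪∁p⊇⊤ : ⊤ ⊆ q ∪ ∁ p
    q∪∁p⊇⊤ {x} _ with x ∈? p
    ... | yes x∈p = x∈p∪q⁺ (inj₁ (p⊆q x∈p))
    ... | no x∉p = x∈p∪q⁺ (inj₂ (x∉p⇒x∈∁p x∉p))

  p∩q∪p∩∁q∪∁p≡⊤ : ∀ (p q : Subset n) → p ∩ q ∪ p ∩ ∁ q ∪ ∁ p ≡ ⊤
  p∩q∪p∩∁q∪∁p≡⊤ p q = begin
    p ∩ q ∪ p ∩ ∁ q ∪ ∁ p     ≡⟨ ∪-assoc (p ∩ q) (p ∩ ∁ q) (∁ p) ⟨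
    (p ∩ q ∪ p ∩ ∁ q) ∪ ∁ p   ≡⟨ cong (_∪ ∁ p) (∩-distribˡ-∪ p q (∁ q)) ⟨
    p ∩ (q ∪ ∁ q) ∪ ∁ p       ≡⟨ cong (λ z → p ∩ z ∪ ∁ p) (∪-inverseʳ q) ⟩
    p ∩ ⊤ ∪ ∁ p               ≡⟨ cong (_∪ ∁ p) (∩-identityʳ p) ⟩
    p ∪ ∁ p                   ≡⟨ ∪-inverseʳ p ⟩
    ⊤                         ∎
    where open ≡-Reasoning

Submodular : ∀ {n} → (Subset n → ℕ) → Set
Submodular f = ∀ X Y → f (X ∩ Y) + f (X ∪ Y) ≤ f X + f Y

module _ {n : ℕ} (f : Subset n → ℕ) where

  connFromRank-∁ : ∀ X → connFromRank f (∁ X) ≡ connFromRank f X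
  connFromRank-∁ X rewrite ∁-involutive X = cong (λ z → z + 1 ∸ f ⊤) (+-comm (f (∁ X)) (f X))

  -- The truncated subtraction in connFromRank never truncates, as f ⊤ ≤ f X + f (∁ X).
  connFromRank-+ : Submodular f → ∀ X → connFromRank f X + f ⊤ ≡ f X + f (∁ X) + 1
  connFromRank-+ submodular X = m∸n+n≡m (begin
    f ⊤                           ≤⟨ m≤n+m _ _ ⟩
    f (X ∩ ∁ X) + f ⊤             ≡⟨ cong (λ Z → f (X ∩ ∁ X) + f Z) (∪-inverseʳ X) ⟨
    f (X ∩ ∁ X) + f (X ∪ ∁ X)     ≤⟨ submodular X (∁ X) ⟩
    f X + f (∁ X)                 ≤⟨ m≤m+n _ 1 ⟩
    f X + f (∁ X) + 1             ∎)
    where open ≤-Reasoning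

module _ {n : ℕ} {λ′ : Subset n → ℕ} {t : ℕ} {𝒯 : SetFamily n} (τ : IsTangle λ′ t 𝒯) where
  open IsTangle τ

  tangle-∁ : ∀ {A} → λ′ A < t → 𝒯 A ≡ false → 𝒯 (∁ A) ≡ true
  tangle-∁ {A} small A∉𝒯 = begin
    𝒯 (∁ A)             ≡⟨ not-involutive _ ⟨
    not (not (𝒯 (∁ A))) ≡⟨ cong not (exactlyOne A small) ⟨
    not (𝒯 A)           ≡⟨ cong not A∉𝒯 ⟩
    true                ∎
    where open ≡-Reasoning

  tangle-⊤ : 𝒯 ⊤ ≢ true
  tangle-⊤ ⊤∈𝒯 = noCover ⊤ ⊤ ⊤ ⊤∈𝒯 ⊤∈𝒯 ⊤∈𝒯 (∪-zeroˡ (⊤ ∪ ⊤))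

  tangle-⊆ : ∀ {C Q} → 𝒯 C ≡ true → Q ⊆ C → λ′ Q < t → 𝒯 Q ≡ true
  tangle-⊆ {C} {Q} C∈𝒯 Q⊆C small with 𝒯 Q in Q∈?𝒯
  ... | true = refl
  ... | false = ⊥-elim (noCover C (∁ Q) (∁ Q) C∈𝒯 ∁Q∈𝒯 ∁Q∈𝒯
                          (trans (cong (C ∪_) (∪-idem (∁ Q))) (p⊆q⇒q∪∁p≡⊤ Q⊆C)))
    where
    ∁Q∈𝒯 : 𝒯 (∁ Q) ≡ true
    ∁Q∈𝒯 = tangle-∁ small Q∈?𝒯

tangle-respects : ∀ {n} {λ′ : Subset n → ℕ} {t} → IsTangle λ′ t Respects _≗_
tangle-respects {λ′ = λ′} {t} {𝒯} {𝒯′} 𝒯≗𝒯′ τ = record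
  { inS        = λ X X∈ → inS X (trans (𝒯≗𝒯′ X) X∈)
  ; exactlyOne = λ A small → trans (sym (𝒯≗𝒯′ A)) (trans (exactlyOne A small) (cong not (𝒯≗𝒯′ (∁ A))))
  ; noCover    = λ T₁ T₂ T₃ T₁∈ T₂∈ T₃∈ →
                   noCover T₁ T₂ T₃ (trans (𝒯≗𝒯′ T₁) T₁∈) (trans (𝒯≗𝒯′ T₂) T₂∈) (trans (𝒯≗𝒯′ T₃) T₃∈)
  ; noBig      = λ X X∈ → noBig X (trans (𝒯≗𝒯′ X) X∈)
  }
  where open IsTangle τ

record DistinctTangles {n : ℕ} (λ′ : Subset n → ℕ) (k : ℕ) : Set where
  constructor distinct
  field
    order     : ℕ
    order≤k   : order ≤ k
    𝒯₁ 𝒯₂     : SetFamily n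
    τ₁        : IsTangle λ′ order 𝒯₁
    τ₂        : IsTangle λ′ order 𝒯₂
    A         : Subset n
    A∈𝒯₁      : 𝒯₁ A ≡ true
    ∁A∈𝒯₂     : 𝒯₂ (∁ A) ≡ true

separating-set : ∀ {n} {λ′ : Subset n → ℕ} {t} {𝒯 𝒯′ : SetFamily n} → IsTangle λ′ t 𝒯 → IsTangle λ′ t 𝒯′ →
                 ∀ {X} → 𝒯 X ≢ 𝒯′ X → Σ[ A ∈ Subset n ] 𝒯 A ≡ true × 𝒯′ (∁ A) ≡ true
separating-set {𝒯 = 𝒯} {𝒯′} τ τ′ {X} X≢ with 𝒯 X in X∈?𝒯 | 𝒯′ X in X∈?𝒯′
... | true  | true  = ⊥-elim (X≢ refl)
... | false | false = ⊥-elim (X≢ refl)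
... | true  | false = X , X∈?𝒯 , tangle-∁ τ′ (IsTangle.inS τ X X∈?𝒯) X∈?𝒯′
... | false | true  = ∁ X , tangle-∁ τ (IsTangle.inS τ′ X X∈?𝒯′) X∈?𝒯 , trans (cong 𝒯′ (∁-involutive X)) X∈?𝒯′

¬distinct⇒entangled : ∀ {n} {λ′ : Subset n → ℕ} {k} → ¬ DistinctTangles λ′ k → Entangled λ′ k
¬distinct⇒entangled ¬distinct t t≤k 𝒯 𝒯′ τ τ′ X = decidable-stable (𝒯 X ≟ᵇ 𝒯′ X) λ X≢ →
  let (A , A∈𝒯 , ∁A∈𝒯′) = separating-set τ τ′ X≢ in ¬distinct (distinct t t≤k 𝒯 𝒯′ τ τ′ A A∈𝒯 ∁A∈𝒯′)

allSubsets? : ∀ {n} {P : Subset n → Set} → (∀ X → Dec (P X)) → Dec (∀ X → P X)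
allSubsets? P? with anySubset? (¬? ∘ P?)
... | yes (X , ¬PX) = no λ ∀P → ¬PX (∀P X)
... | no ∄¬P = yes λ X → decidable-stable (P? X) λ ¬PX → ∄¬P (X , ¬PX)

-- A family is a function, so exhaustive search over families only makes sense for extensional P.
allFamilies? : ∀ {n} {P : SetFamily n → Set} → P Respects _≗_ → (∀ 𝒯 → Dec (P 𝒯)) → Dec (∀ 𝒯 → P 𝒯)
allFamilies? {zero} {P} resp P? =
  map′ (λ ∀P 𝒯 → resp (λ { [] → refl }) (∀P (𝒯 []))) (λ ∀P b → ∀P λ _ → b)
       (map′ (λ { (P-true , P-false) → λ { true → P-true ; false → P-false } }) (λ ∀P → ∀P true , ∀P false)
             (P? (λ _ → true) ×-dec P? (λ _ → false)))
allFamilies? {suc n} {P} resp P? =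
  map′ (λ ∀P 𝒯 → resp (glue-split 𝒯) (∀P (𝒯 ∘ (false ∷_)) (𝒯 ∘ (true ∷_)))) (λ ∀P 𝒯₀ 𝒯₁ → ∀P (glue 𝒯₀ 𝒯₁))
       (allFamilies? resp₀ λ 𝒯₀ → allFamilies? (resp₁ 𝒯₀) λ 𝒯₁ → P? (glue 𝒯₀ 𝒯₁))
  where
  glue : SetFamily n → SetFamily n → SetFamily (suc n)
  glue 𝒯₀ 𝒯₁ (false ∷ X) = 𝒯₀ X
  glue 𝒯₀ 𝒯₁ (true ∷ X) = 𝒯₁ X

  glue-split : ∀ 𝒯 → glue (𝒯 ∘ (false ∷_)) (𝒯 ∘ (true ∷_)) ≗ 𝒯
  glue-split 𝒯 (false ∷ X) = refl
  glue-split 𝒯 (true ∷ X) = refl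

  glue-cong : ∀ {𝒯₀ 𝒯₀′ 𝒯₁ 𝒯₁′} → 𝒯₀ ≗ 𝒯₀′ → 𝒯₁ ≗ 𝒯₁′ → glue 𝒯₀ 𝒯₁ ≗ glue 𝒯₀′ 𝒯₁′
  glue-cong eq₀ eq₁ (false ∷ X) = eq₀ X
  glue-cong eq₀ eq₁ (true ∷ X) = eq₁ X

  resp₁ : ∀ 𝒯₀ → (λ 𝒯₁ → P (glue 𝒯₀ 𝒯₁)) Respects _≗_
  resp₁ 𝒯₀ eq = resp (glue-cong (λ _ → refl) eq)

  resp₀ : (λ 𝒯₀ → ∀ 𝒯₁ → P (glue 𝒯₀ 𝒯₁)) Respects _≗_
  resp₀ eq ∀P 𝒯₁ = resp (glue-cong eq (λ _ → refl)) (∀P 𝒯₁)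

isTangle? : ∀ {n} (λ′ : Subset n → ℕ) t 𝒯 → Dec (IsTangle λ′ t 𝒯)
isTangle? {n} λ′ t 𝒯 =
  map′ (λ { (a , b , c , d) → record { inS = a ; exactlyOne = b ; noCover = c ; noBig = d } })
       (λ τ → let open IsTangle τ in inS , exactlyOne , noCover , noBig)
       (allSubsets? (λ X → member? X →-dec λ′ X <? t)
        ×-dec allSubsets? (λ A → λ′ A <? t →-dec 𝒯 A ≟ᵇ not (𝒯 (∁ A)))
        ×-dec allSubsets? (λ T₁ → allSubsets? λ T₂ → allSubsets? λ T₃ →
                member? T₁ →-dec member? T₂ →-dec member? T₃ →-dec ¬? (≡-dec _≟ᵇ_ (T₁ ∪ T₂ ∪ T₃) ⊤))
        ×-dec allSubsets? (λ X → member? X →-dec ¬? (suc ∣ X ∣ ≟ℕ n)))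
  where
  member? : ∀ X → Dec (𝒯 X ≡ true)
  member? X = 𝒯 X ≟ᵇ true

entangled? : ∀ {n} (λ′ : Subset n → ℕ) k → Dec (Entangled λ′ k)
entangled? {n} λ′ k =
  map′ (λ ∀Agree t t≤k → ∀Agree (s≤s t≤k)) (λ ent {t} t<1+k → ent t (s≤s⁻¹ t<1+k)) (allUpTo? agree? (suc k))
  where
  Agree : ℕ → SetFamily n → SetFamily n → Set
  Agree t 𝒯 𝒯′ = IsTangle λ′ t 𝒯 → IsTangle λ′ t 𝒯′ → ∀ X → 𝒯 X ≡ 𝒯′ X

  agree-respects : ∀ t 𝒯 → Agree t 𝒯 Respects _≗_
  agree-respects t 𝒯 eq agree τ τ′ X = trans (agree τ (tangle-respects (sym ∘ eq) τ′) X) (eq X)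

  all-agree-respects : ∀ t → (λ 𝒯 → ∀ 𝒯′ → Agree t 𝒯 𝒯′) Respects _≗_
  all-agree-respects t eq agree 𝒯′ τ τ′ X = trans (sym (eq X)) (agree 𝒯′ (tangle-respects (sym ∘ eq) τ) τ′ X)

  agree? : ∀ t → Dec (∀ 𝒯 𝒯′ → Agree t 𝒯 𝒯′)
  agree? t = allFamilies? (all-agree-respects t) λ 𝒯 → allFamilies? (agree-respects t 𝒯) λ 𝒯′ →
    isTangle? λ′ t 𝒯 →-dec isTangle? λ′ t 𝒯′ →-dec allSubsets? λ X → 𝒯 X ≟ᵇ 𝒯′ X

Dominates : ∀ {n} → (Subset (suc n) → ℕ) → Fin (suc n) → (Subset n → ℕ) → Set
Dominates λM e λN = ∀ X b → λN X ≤ λM (insertAt X e b)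

BixbyInequality : ∀ {n} → (Subset (suc n) → ℕ) → Fin (suc n) → (Subset n → ℕ) → (Subset n → ℕ) → Set
BixbyInequality λM e λD λC =
  ∀ X Y → λM (insertAt (X ∩ Y) e outside) + λM (insertAt (X ∪ Y) e inside) ≤ λD X + λC Y + 1

liftFamily : ∀ {n} → (Subset (suc n) → ℕ) → Fin (suc n) → ℕ → SetFamily n → SetFamily (suc n)
liftFamily λM e t 𝒯 Z = does (λM Z <? t) ∧ 𝒯 (removeAt Z e)

module _ {n : ℕ} {λM : Subset (suc n) → ℕ} (λM-∁ : ∀ Z → λM (∁ Z) ≡ λM Z) (e : Fin (suc n)) where

  dominates-outside : ∀ {λN} → (∀ X → λN (∁ X) ≡ λN X) → (∀ X → λN X ≤ λM (insertAt X e outside)) →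
                      Dominates λM e λN
  dominates-outside λN-∁ bound X outside = bound X
  dominates-outside {λN} λN-∁ bound X inside = begin
    λN X                           ≡⟨ λN-∁ X ⟨
    λN (∁ X)                       ≤⟨ bound (∁ X) ⟩
    λM (insertAt (∁ X) e outside)  ≡⟨ cong λM (∁-insertAt X e inside) ⟨
    λM (∁ (insertAt X e inside))   ≡⟨ λM-∁ _ ⟩
    λM (insertAt X e inside)       ∎
    where open ≤-Reasoning

  dominates-removeAt : ∀ {λN} → Dominates λM e λN → ∀ Z → λN (removeAt Z e) ≤ λM Z
  dominates-removeAt {λN} dom Z =
    subst (λ W → λN (removeAt Z e) ≤ λM W) (insertAt-removeAt Z e) (dom (removeAt Z e) (lookup Z e))

  module _ {t : ℕ} {𝒯 : SetFamily n} where

    liftFamily-small : ∀ {Z} → λM Z < t → liftFamily λM e t 𝒯 Z ≡ 𝒯 (removeAt Z e)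
    liftFamily-small {Z} small = cong (_∧ 𝒯 (removeAt Z e)) (dec-true (λM Z <? t) small)

    liftFamily-true : ∀ Z → liftFamily λM e t 𝒯 Z ≡ true → λM Z < t × 𝒯 (removeAt Z e) ≡ true
    liftFamily-true Z Z∈ with λM Z <? t
    ... | yes small = small , trans (sym (liftFamily-small small)) Z∈
    ... | no large = ⊥-elim (false≢true (trans (sym (cong (_∧ 𝒯 (removeAt Z e)) (dec-false (λM Z <? t) large))) Z∈))
      where
      false≢true : false ≢ true
      false≢true ()

    liftTangle : ∀ {λN} → Dominates λM e λN → IsTangle λN t 𝒯 → IsTangle λM t (liftFamily λM e t 𝒯)
    liftTangle {λN} dom τ = record
      { inS        = λ Z Z∈ → proj₁ (liftFamily-true Z Z∈)
      ; exactlyOne = exactlyOne′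
      ; noCover    = λ T₁ T₂ T₃ T₁∈ T₂∈ T₃∈ cover →
          noCover _ _ _ (proj₂ (liftFamily-true T₁ T₁∈)) (proj₂ (liftFamily-true T₂ T₂∈))
                  (proj₂ (liftFamily-true T₃ T₃∈)) (removeAt-cover T₁ T₂ T₃ cover)
      ; noBig      = noBig′
      }
      where
      open IsTangle τ
      open ≡-Reasoning

      exactlyOne′ : ∀ A → λM A < t → liftFamily λM e t 𝒯 A ≡ not (liftFamily λM e t 𝒯 (∁ A))
      exactlyOne′ A small = begin
        liftFamily λM e t 𝒯 A                ≡⟨ liftFamily-small small ⟩
        𝒯 (removeAt A e)                     ≡⟨ exactlyOne _ (≤-<-trans (dominates-removeAt dom A) small) ⟩
        not (𝒯 (∁ (removeAt A e)))           ≡⟨ cong (not ∘ 𝒯) (removeAt-map not A e) ⟨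
        not (𝒯 (removeAt (∁ A) e))           ≡⟨ cong not (liftFamily-small (subst (_< t) (sym (λM-∁ A)) small)) ⟨
        not (liftFamily λM e t 𝒯 (∁ A))      ∎

      removeAt-cover : ∀ T₁ T₂ T₃ → T₁ ∪ T₂ ∪ T₃ ≡ ⊤ → removeAt T₁ e ∪ removeAt T₂ e ∪ removeAt T₃ e ≡ ⊤
      removeAt-cover T₁ T₂ T₃ cover = begin
        removeAt T₁ e ∪ removeAt T₂ e ∪ removeAt T₃ e  ≡⟨ cong (removeAt T₁ e ∪_) (removeAt-∪ T₂ T₃ e) ⟨
        removeAt T₁ e ∪ removeAt (T₂ ∪ T₃) e           ≡⟨ removeAt-∪ T₁ (T₂ ∪ T₃) e ⟨
        removeAt (T₁ ∪ T₂ ∪ T₃) e                      ≡⟨ cong (λ Z → removeAt Z e) cover ⟩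
        removeAt ⊤ e                                   ≡⟨ removeAt-⊤ e ⟩
        ⊤                                              ∎

      -- If Z - e is not already too big for 𝒯, then it is all of E - e, which no tangle contains.
      noBig′ : ∀ Z → liftFamily λM e t 𝒯 Z ≡ true → suc ∣ Z ∣ ≢ suc n
      noBig′ Z Z∈ ∣Z∣≡n with m≤n⇒m<n∨m≡n (subst (_≤ suc ∣ removeAt Z e ∣) (suc-injective ∣Z∣≡n)
                                                (∣p∣≤1+∣removeAt-p∣ Z e))
      ... | inj₁ n<1+∣Z′∣ = tangle-⊤ τ (subst (λ W → 𝒯 W ≡ true)
                                        (∣p∣≡n⇒p≡⊤ (≤-antisym (∣p∣≤n (removeAt Z e)) (s≤s⁻¹ n<1+∣Z′∣)))
                                        (proj₂ (liftFamily-true Z Z∈)))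
      ... | inj₂ n≡1+∣Z′∣ = noBig _ (proj₂ (liftFamily-true Z Z∈)) (sym n≡1+∣Z′∣)

  module _ {k : ℕ} (ent : Entangled λM k) {λN : Subset n → ℕ} (dom : Dominates λM e λN)
           {t : ℕ} (t≤k : t ≤ k) {𝒯 𝒯′ : SetFamily n} (τ : IsTangle λN t 𝒯) (τ′ : IsTangle λN t 𝒯′) where

    tangles-agree : ∀ Q b → λM (insertAt Q e b) < t → 𝒯 Q ≡ 𝒯′ Q
    tangles-agree Q b small = begin
      𝒯 Q                                      ≡⟨ cong 𝒯 (removeAt-insertAt Q e b) ⟨
      𝒯 (removeAt Z e)                         ≡⟨ liftFamily-small {𝒯 = 𝒯} small ⟨
      liftFamily λM e t 𝒯 Z                    ≡⟨ ent t t≤k _ _ (liftTangle dom τ) (liftTangle dom τ′) Z ⟩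
      liftFamily λM e t 𝒯′ Z                   ≡⟨ liftFamily-small {𝒯 = 𝒯′} small ⟩
      𝒯′ (removeAt Z e)                        ≡⟨ cong 𝒯′ (removeAt-insertAt Q e b) ⟩
      𝒯′ Q                                     ∎
      where
      Z : Subset (suc n)
      Z = insertAt Q e b
      open ≡-Reasoning

    tangle-transfer : ∀ {C Q} → 𝒯 C ≡ true → Q ⊆ C → λM (insertAt Q e outside) < t → 𝒯′ Q ≡ true
    tangle-transfer {C} {Q} C∈𝒯 Q⊆C small =
      trans (sym (tangles-agree Q outside small)) (tangle-⊆ τ C∈𝒯 Q⊆C (≤-<-trans (dom Q outside) small))

    halves-not-both-small : ∀ {P Q} → 𝒯 P ≡ true → 𝒯′ (∁ P) ≡ true →
                            λM (insertAt (P ∩ Q) e outside) < t → λM (insertAt (P ∩ ∁ Q) e outside) < t → ⊥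
    halves-not-both-small {P} {Q} P∈𝒯 ∁P∈𝒯′ small small′ =
      IsTangle.noCover τ′ _ _ _ (tangle-transfer P∈𝒯 (p∩q⊆p P Q) small) (tangle-transfer P∈𝒯 (p∩q⊆p P (∁ Q)) small′)
                       ∁P∈𝒯′ (p∩q∪p∩∁q∪∁p≡⊤ P Q)

+-≤-split : ∀ {a d x y t s} → a + d ≤ x + y + 1 → x < t → y < s → a < t ⊎ d < s
+-≤-split {a} {d} {x} {y} {t} {s} a+d≤ x<t y<s with a <? t | d <? s
... | yes a<t | _       = inj₁ a<t
... | no _    | yes d<s = inj₂ d<s
... | no a≮t  | no d≮s  = ⊥-elim (n≮n (x + y + 1) (begin-strict
  x + y + 1              ≡⟨ +-comm (x + y) 1 ⟩
  suc (x + y)            <⟨ n<1+n _ ⟩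
  suc (suc (x + y))      ≡⟨ cong suc (+-suc x y) ⟨
  suc x + suc y          ≤⟨ +-mono-≤ x<t y<s ⟩
  t + s                  ≤⟨ +-mono-≤ (≮⇒≥ a≮t) (≮⇒≥ d≮s) ⟩
  a + d                  ≤⟨ a+d≤ ⟩
  x + y + 1              ∎))
  where open ≤-Reasoning

-- Connectivities are compared after adding back the ranks they are shifted by, so that no
-- truncated subtraction is involved.
cancel-offsets : ∀ {x y o₁ o₂ s₁ s₂} → x + o₁ ≡ s₁ + 1 → y + o₂ ≡ s₂ + 1 → s₁ + o₂ ≤ s₂ + o₁ → x ≤ y
cancel-offsets {x} {y} {o₁} {o₂} {s₁} {s₂} x≡ y≡ s₁≤s₂ = +-cancelʳ-≤ (o₁ + o₂) x y (begin
  x + (o₁ + o₂)     ≡⟨ +-assoc x o₁ o₂ ⟨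
  x + o₁ + o₂       ≡⟨ cong (_+ o₂) x≡ ⟩
  s₁ + 1 + o₂       ≡⟨ cong (_+ o₂) (+-comm s₁ 1) ⟩
  1 + (s₁ + o₂)     ≤⟨ +-monoʳ-≤ 1 s₁≤s₂ ⟩
  1 + (s₂ + o₁)     ≡⟨ cong (_+ o₁) (+-comm 1 s₂) ⟩
  s₂ + 1 + o₁       ≡⟨ cong (_+ o₁) y≡ ⟨
  y + o₂ + o₁       ≡⟨ +-assoc y o₂ o₁ ⟩
  y + (o₂ + o₁)     ≡⟨ cong (y +_) (+-comm o₂ o₁) ⟩
  y + (o₁ + o₂)     ∎)
  where open ≤-Reasoning

private
  quadrants-≤ : ∀ {a b c d t s : ℕ} → t ≤ s →
    a < t ⊎ d < s → d < t ⊎ a < s → b < t ⊎ c < s → c < t ⊎ b < s →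
    (a < t → b < t → ⊥) → (c < t → d < t → ⊥) → (a < s → c < s → ⊥) → (b < s → d < s → ⊥) → ⊥
  quadrants-≤ t≤s (inj₁ a) _ (inj₁ b) _ f₁ _ _ _ = f₁ a b
  quadrants-≤ t≤s (inj₁ a) _ (inj₂ c) _ _ _ f₃ _ = f₃ (<-≤-trans a t≤s) c
  quadrants-≤ t≤s (inj₂ d) _ (inj₁ b) _ _ _ _ f₄ = f₄ (<-≤-trans b t≤s) d
  quadrants-≤ t≤s (inj₂ d) _ (inj₂ c) (inj₂ b) _ _ _ f₄ = f₄ b d
  quadrants-≤ t≤s (inj₂ d) (inj₁ d′) (inj₂ c) (inj₁ c′) _ f₂ _ _ = f₂ c′ d′
  quadrants-≤ t≤s (inj₂ d) (inj₂ a) (inj₂ c) (inj₁ _) _ _ f₃ _ = f₃ a c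

-- a, b, c, d are the orders of the quadrants A ∩ B, A ∩ ∁B, ∁A ∩ B, ∁A ∩ ∁B of a cross.
quadrants : ∀ {a b c d t s : ℕ} →
  a < t ⊎ d < s → d < t ⊎ a < s → b < t ⊎ c < s → c < t ⊎ b < s →
  (a < t → b < t → ⊥) → (c < t → d < t → ⊥) → (a < s → c < s → ⊥) → (b < s → d < s → ⊥) → ⊥
quadrants {t = t} {s} h₁ h₂ h₃ h₄ f₁ f₂ f₃ f₄ with ≤-total t s
... | inj₁ t≤s = quadrants-≤ t≤s h₁ h₂ h₃ h₄ f₁ f₂ f₃ f₄
... | inj₂ s≤t = quadrants-≤ s≤t (swap h₂) (swap h₁) (swap h₃) (swap h₄) f₃ f₄ f₁ f₂

module _ {n : ℕ} {λM : Subset (suc n) → ℕ} (λM-∁ : ∀ Z → λM (∁ Z) ≡ λM Z) (e : Fin (suc n))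
         {k : ℕ} (ent : Entangled λM k) {λD λC : Subset n → ℕ}
         (domD : Dominates λM e λD) (domC : Dominates λM e λC) (bixby : BixbyInequality λM e λD λC) where

  private
    μ : Subset n → ℕ
    μ Q = λM (insertAt Q e outside)

  bixby-split : ∀ {X Y X̄ Ȳ t s} → λD X < t → λC Y < s → ∁ X ≡ X̄ → ∁ Y ≡ Ȳ → μ (X ∩ Y) < t ⊎ μ (X̄ ∩ Ȳ) < s
  bixby-split {X} {Y} X-small Y-small refl refl =
    +-≤-split (subst (λ z → μ (X ∩ Y) + z ≤ λD X + λC Y + 1) μ-∪ (bixby X Y)) X-small Y-small
    where
    μ-∪ : λM (insertAt (X ∪ Y) e inside) ≡ μ (∁ X ∩ ∁ Y)
    μ-∪ = begin
      λM (insertAt (X ∪ Y) e inside)         ≡⟨ λM-∁ _ ⟨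
      λM (∁ (insertAt (X ∪ Y) e inside))     ≡⟨ cong λM (∁-insertAt (X ∪ Y) e inside) ⟩
      μ (∁ (X ∪ Y))                          ≡⟨ cong μ (∁-∪ X Y) ⟩
      μ (∁ X ∩ ∁ Y)                          ∎
      where open ≡-Reasoning

  distinct-tangles-clash : DistinctTangles λD k → ¬ DistinctTangles λC k
  distinct-tangles-clash (distinct t t≤k 𝒯₁ 𝒯₂ τ₁ τ₂ A A∈𝒯₁ ∁A∈𝒯₂)
                         (distinct s s≤k 𝒰₁ 𝒰₂ υ₁ υ₂ B B∈𝒰₁ ∁B∈𝒰₂) =
    quadrants
      (bixby-split A-small B-small refl refl)
      (bixby-split ∁A-small ∁B-small (∁-involutive A) (∁-involutive B))
      (bixby-split A-small ∁B-small refl (∁-involutive B))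
      (bixby-split ∁A-small B-small (∁-involutive A) refl)
      (halves-not-both-small λM-∁ e ent domD t≤k τ₁ τ₂ A∈𝒯₁ ∁A∈𝒯₂)
      (halves-not-both-small λM-∁ e ent domD t≤k τ₂ τ₁ ∁A∈𝒯₂ (∁∁-member 𝒯₁ A∈𝒯₁))
      (λ a c → halves-not-both-small λM-∁ e ent domC s≤k υ₁ υ₂ B∈𝒰₁ ∁B∈𝒰₂ (commute a) (commute c))
      (λ b d → halves-not-both-small λM-∁ e ent domC s≤k υ₂ υ₁ ∁B∈𝒰₂ (∁∁-member 𝒰₁ B∈𝒰₁)
                 (commute b) (commute d))
    where
    A-small : λD A < t
    A-small = IsTangle.inS τ₁ A A∈𝒯₁
    ∁A-small : λD (∁ A) < t
    ∁A-small = IsTangle.inS τ₂ (∁ A) ∁A∈𝒯₂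
    B-small : λC B < s
    B-small = IsTangle.inS υ₁ B B∈𝒰₁
    ∁B-small : λC (∁ B) < s
    ∁B-small = IsTangle.inS υ₂ (∁ B) ∁B∈𝒰₂

    ∁∁-member : ∀ (𝒯 : SetFamily n) {X} → 𝒯 X ≡ true → 𝒯 (∁ (∁ X)) ≡ true
    ∁∁-member 𝒯 {X} = trans (cong 𝒯 (∁-involutive X))

    commute : ∀ {P Q u} → μ (P ∩ Q) < u → μ (Q ∩ P) < u
    commute {P} {Q} {u} = subst (λ Z → μ Z < u) (∩-comm P Q)

module _ {n : ℕ} (M : Matroid (suc n)) (e : Fin (suc n)) where

  private
    r : Subset (suc n) → ℕ
    r = rank M

    ρ : ℕ
    ρ = r ⁅ e ⁆

    λM : Subset (suc n) → ℕ
    λM = connFromRank r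

    λD λC : Subset n → ℕ
    λD = connFromRank (deleteRank M e)
    λC = connFromRank (contractRank M e)

    c : Subset n → ℕ
    c = contractRank M e

    infix 10 _⁺ _⁻
    _⁺ _⁻ : Subset n → Subset (suc n)
    X ⁺ = insertAt X e inside
    X ⁻ = insertAt X e outside

  insertAt-submodular : ∀ X Y b b′ → r (insertAt (X ∩ Y) e (b ∧ b′)) + r (insertAt (X ∪ Y) e (b ∨ b′)) ≤
                                     r (insertAt X e b) + r (insertAt Y e b′)
  insertAt-submodular X Y b b′ =
    subst₂ (λ U V → r U + r V ≤ r (insertAt X e b) + r (insertAt Y e b′))
           (zipWith-insertAt _∧_ X Y e b b′) (zipWith-insertAt _∨_ X Y e b b′)
           (rank-submod M (insertAt X e b) (insertAt Y e b′))

  deleteRank-submodular : Submodular (deleteRank M e)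
  deleteRank-submodular X Y = insertAt-submodular X Y outside outside

  ρ≤1 : ρ ≤ 1
  ρ≤1 = subst (ρ ≤_) (∣⁅x⁆∣≡1 e) (rank-bound M ⁅ e ⁆)

  contractRank-+ : ∀ X → contractRank M e X + ρ ≡ r (X ⁺)
  contractRank-+ X = m∸n+n≡m (rank-mono M (⁅i⁆⊆insertAt X e))

  contractRank-⊤ : contractRank M e ⊤ + ρ ≡ r ⊤
  contractRank-⊤ = trans (contractRank-+ ⊤) (cong r (insertAt-⊤ e))

  contractRank-submodular : Submodular (contractRank M e)
  contractRank-submodular X Y = +-cancelʳ-≤ (ρ + ρ) _ _ (begin
    c (X ∩ Y) + c (X ∪ Y) + (ρ + ρ)     ≡⟨ interchange (c (X ∩ Y)) (c (X ∪ Y)) ρ ⟩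
    (c (X ∩ Y) + ρ) + (c (X ∪ Y) + ρ)   ≡⟨ cong₂ _+_ (contractRank-+ (X ∩ Y)) (contractRank-+ (X ∪ Y)) ⟩
    r ((X ∩ Y) ⁺) + r ((X ∪ Y) ⁺)       ≤⟨ insertAt-submodular X Y inside inside ⟩
    r (X ⁺) + r (Y ⁺)                   ≡⟨ cong₂ _+_ (contractRank-+ X) (contractRank-+ Y) ⟨
    (c X + ρ) + (c Y + ρ)               ≡⟨ interchange (c X) (c Y) ρ ⟨
    c X + c Y + (ρ + ρ)                 ∎)
    where
    open ≤-Reasoning
    interchange : ∀ a b x → a + b + (x + x) ≡ (a + x) + (b + x)
    interchange = solve-∀

  r⁺≤r⁻+ρ : ∀ X → r (X ⁺) ≤ r (X ⁻) + ρ
  r⁺≤r⁻+ρ X = ≤-trans (m≤n+m _ _)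
    (subst₂ (λ U V → r ((X ∩ ∅) ⁻) + r (U ⁺) ≤ r (X ⁻) + r V) (∪-identityʳ X) (insertAt-∅ e)
            (insertAt-submodular X ∅ outside inside))

  r⁻+r⊤≤r⁺+r⊤⁻ : ∀ X → r (X ⁻) + r ⊤ ≤ r (X ⁺) + r (⊤ ⁻)
  r⁻+r⊤≤r⁺+r⊤⁻ X =
    subst₂ (λ U V → r (U ⁻) + r V ≤ r (X ⁺) + r (⊤ ⁻))
           (∩-identityʳ X) (trans (cong _⁺ (∪-zeroʳ X)) (insertAt-⊤ e))
           (insertAt-submodular X ⊤ inside outside)

  λM-insertAt : ∀ X b → λM (insertAt X e b) + r ⊤ ≡ r (insertAt X e b) + r (insertAt (∁ X) e (not b)) + 1
  λM-insertAt X b =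
    subst (λ W → λM (insertAt X e b) + r ⊤ ≡ r (insertAt X e b) + r W + 1) (∁-insertAt X e b)
          (connFromRank-+ r (rank-submod M) (insertAt X e b))

  λD-+ : ∀ X → λD X + r (⊤ ⁻) ≡ r (X ⁻) + r (∁ X ⁻) + 1
  λD-+ = connFromRank-+ (deleteRank M e) deleteRank-submodular

  λC-+ : ∀ X → λC X + (r ⊤ + ρ) ≡ r (X ⁺) + r (∁ X ⁺) + 1
  λC-+ X = begin
    λC X + (r ⊤ + ρ)                  ≡⟨ cong (λ z → λC X + (z + ρ)) contractRank-⊤ ⟨
    λC X + (c ⊤ + ρ + ρ)              ≡⟨ shuffle₁ (λC X) (c ⊤) ρ ⟩
    (λC X + c ⊤) + (ρ + ρ)            ≡⟨ cong (_+ (ρ + ρ)) (connFromRank-+ (contractRank M e) contractRank-submodular X) ⟩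
    (c X + c (∁ X) + 1) + (ρ + ρ)     ≡⟨ shuffle₂ (c X) (c (∁ X)) ρ ⟩
    (c X + ρ) + (c (∁ X) + ρ) + 1     ≡⟨ cong₂ (λ u v → u + v + 1) (contractRank-+ X) (contractRank-+ (∁ X)) ⟩
    r (X ⁺) + r (∁ X ⁺) + 1           ∎
    where
    open ≡-Reasoning
    shuffle₁ : ∀ l a x → l + (a + x + x) ≡ (l + a) + (x + x)
    shuffle₁ = solve-∀
    shuffle₂ : ∀ a b x → (a + b + 1) + (x + x) ≡ (a + x) + (b + x) + 1
    shuffle₂ = solve-∀

  deletion-dominated : Dominates λM e λD
  deletion-dominated = dominates-outside (connFromRank-∁ r) e (connFromRank-∁ (deleteRank M e)) λ X →
    cancel-offsets (λD-+ X) (λM-insertAt X outside) (begin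
      r (X ⁻) + r (∁ X ⁻) + r ⊤       ≡⟨ +-assoc (r (X ⁻)) (r (∁ X ⁻)) (r ⊤) ⟩
      r (X ⁻) + (r (∁ X ⁻) + r ⊤)     ≤⟨ +-monoʳ-≤ (r (X ⁻)) (r⁻+r⊤≤r⁺+r⊤⁻ (∁ X)) ⟩
      r (X ⁻) + (r (∁ X ⁺) + r (⊤ ⁻)) ≡⟨ +-assoc (r (X ⁻)) (r (∁ X ⁺)) (r (⊤ ⁻)) ⟨
      r (X ⁻) + r (∁ X ⁺) + r (⊤ ⁻)   ∎)
    where open ≤-Reasoning

  contraction-dominated : Dominates λM e λC
  contraction-dominated = dominates-outside (connFromRank-∁ r) e (connFromRank-∁ (contractRank M e)) λ X →
    cancel-offsets (λC-+ X) (λM-insertAt X outside) (begin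
      r (X ⁺) + r (∁ X ⁺) + r ⊤         ≤⟨ +-monoˡ-≤ (r ⊤) (+-monoˡ-≤ (r (∁ X ⁺)) (r⁺≤r⁻+ρ X)) ⟩
      r (X ⁻) + ρ + r (∁ X ⁺) + r ⊤     ≡⟨ shuffle (r (X ⁻)) ρ (r (∁ X ⁺)) (r ⊤) ⟩
      r (X ⁻) + r (∁ X ⁺) + (r ⊤ + ρ)   ∎)
    where
    open ≤-Reasoning
    shuffle : ∀ a x b o → a + x + b + o ≡ a + b + (o + x)
    shuffle = solve-∀

  ∁-insertAt-submodular : ∀ X Y → r (∁ (X ∪ Y) ⁻) + r (∁ (X ∩ Y) ⁺) ≤ r (∁ X ⁻) + r (∁ Y ⁺)
  ∁-insertAt-submodular X Y =
    subst₂ (λ U V → r (U ⁻) + r (V ⁺) ≤ r (∁ X ⁻) + r (∁ Y ⁺)) (sym (∁-∪ X Y)) (sym (∁-∩ X Y))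
           (insertAt-submodular (∁ X) (∁ Y) outside inside)

  bixby : BixbyInequality λM e λD λC
  bixby X Y = +-cancelʳ-≤ (r ⊤ + r ⊤) _ _ (begin
    λM ((X ∩ Y) ⁻) + λM ((X ∪ Y) ⁺) + (r ⊤ + r ⊤)
      ≡⟨ shuffle₁ (λM ((X ∩ Y) ⁻)) (λM ((X ∪ Y) ⁺)) (r ⊤) ⟩
    (λM ((X ∩ Y) ⁻) + r ⊤) + (λM ((X ∪ Y) ⁺) + r ⊤)
      ≡⟨ cong₂ _+_ (λM-insertAt (X ∩ Y) outside) (λM-insertAt (X ∪ Y) inside) ⟩
    (r ((X ∩ Y) ⁻) + r (∁ (X ∩ Y) ⁺) + 1) + (r ((X ∪ Y) ⁺) + r (∁ (X ∪ Y) ⁻) + 1)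
      ≡⟨ shuffle₂ (r ((X ∩ Y) ⁻)) (r (∁ (X ∩ Y) ⁺)) (r ((X ∪ Y) ⁺)) (r (∁ (X ∪ Y) ⁻)) ⟩
    (r ((X ∩ Y) ⁻) + r ((X ∪ Y) ⁺)) + (r (∁ (X ∪ Y) ⁻) + r (∁ (X ∩ Y) ⁺)) + 2
      ≤⟨ +-monoˡ-≤ 2 (+-mono-≤ (insertAt-submodular X Y outside inside) (∁-insertAt-submodular X Y)) ⟩
    (r (X ⁻) + r (Y ⁺)) + (r (∁ X ⁻) + r (∁ Y ⁺)) + 2
      ≡⟨ shuffle₃ (r (X ⁻)) (r (Y ⁺)) (r (∁ X ⁻)) (r (∁ Y ⁺)) ⟩
    (r (X ⁻) + r (∁ X ⁻) + 1) + (r (Y ⁺) + r (∁ Y ⁺) + 1)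
      ≡⟨ cong₂ _+_ (λD-+ X) (λC-+ Y) ⟨
    (λD X + r (⊤ ⁻)) + (λC Y + (r ⊤ + ρ))
      ≤⟨ +-mono-≤ (+-monoʳ-≤ (λD X) (rank-mono M ⊆⊤)) (+-monoʳ-≤ (λC Y) (+-monoʳ-≤ (r ⊤) ρ≤1)) ⟩
    (λD X + r ⊤) + (λC Y + (r ⊤ + 1))
      ≡⟨ shuffle₄ (λD X) (λC Y) (r ⊤) ⟩
    λD X + λC Y + 1 + (r ⊤ + r ⊤)
      ∎)
    where
    open ≤-Reasoning
    shuffle₁ : ∀ a b o → a + b + (o + o) ≡ (a + o) + (b + o)
    shuffle₁ = solve-∀
    shuffle₂ : ∀ p q u v → (p + q + 1) + (u + v + 1) ≡ (p + u) + (v + q) + 2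
    shuffle₂ = solve-∀
    shuffle₃ : ∀ p q u v → (p + q) + (u + v) + 2 ≡ (p + u + 1) + (q + v + 1)
    shuffle₃ = solve-∀
    shuffle₄ : ∀ a b o → (a + o) + (b + (o + 1)) ≡ a + b + 1 + (o + o)
    shuffle₄ = solve-∀

-- The argument works for every k.
theorem5p1 : ∀ {n : ℕ} (k : ℕ) → 1 ≤ k → (M : Matroid (suc n)) → (e : Fin (suc n)) →
    MatroidEntangled M k →
    Entangled (connFromRank (deleteRank M e)) k ⊎ Entangled (connFromRank (contractRank M e)) k
theorem5p1 k _ M e ent with entangled? (connFromRank (deleteRank M e)) k
... | yes deletion-entangled = inj₁ deletion-entangled
... | no deletion-not-entangled = inj₂ (¬distinct⇒entangled λ distinctC →
        deletion-not-entangled (¬distinct⇒entangled λ distinctD →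
          distinct-tangles-clash (connFromRank-∁ (rank M)) e ent
            (deletion-dominated M e) (contraction-dominated M e) (bixby M e) distinctD distinctC))
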